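{- Let $q$ be an odd prime power and let $G$ be a decodable graph representation (over $GF(q)$) with $n$ vertices and $m$ edges. Then $\delta_I(G)\le 2m/n$, and therefore $b_G\le 2m/n$.
   Context: Graph representation of a coding scheme on packets $p_1,\dots,p_n\in GF(q)^\ell$ ($n\ge2$): vertices $p_1,\dots,p_n$, an edge joining $p_j,p_k$ per encoding $p_j+p_k$ ($j\ne k$), a loop at $p_j$ per encoding $p_j$ (multigraph, edges distinguishable). A spanning subgraph is decodable if the encodings of its edges determine $p_1,\dots,p_n$ uniquely. $d_I(v)$ is the number of edges incident with $v$ (a loop counts once), $\delta_I(G)=\min_v d_I(v)$. For decodable $G=(V,E)$, $b_G$ is the smallest $|\mathcal L|$, $\mathcal L\subseteq E$, with $(V,E\setminus\mathcal L)$ undecodable. -}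

module Defs where

open import Level using (Level)
open import Data.Nat using (ℕ; zero; suc; _+_; _*_; _^_; _⊓_; _≤_; _%_)
open import Data.Nat.Primality using (Prime)
open import Data.Fin using (Fin; zero; suc; _≟_)
open import Data.Fin.Subset using (Subset; _∈_; ∣_∣)
open import Data.List using (map; allFin)
open import Data.Nat.ListAction using (sum)
open import Data.Product using (Σ; ∃; _×_)
open import Relation.Nullary using (¬_; does)
open import Relation.Binary.PropositionalEquality using (_≡_; _≢_)
open import Data.Bool using (if_then_else_; _∨_)
open import Algebra.Bundles using (CommutativeRing)

OddPrimePower : ℕ → Set
OddPrimePower q = Σ ℕ λ p → Σ ℕ λ k → Prime p × (q ≡ p ^ suc k) × (q % 2 ≡ 1)

module _ {c ℓ : Level} (R : CommutativeRing c ℓ) where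
  open CommutativeRing R using (Carrier; _≈_; 0#; 1#) renaming (_*_ to _·_)

  IsField : Set (c Level.⊔ ℓ)
  IsField = (¬ (1# ≈ 0#)) × (∀ x → ¬ (x ≈ 0#) → ∃ λ y → (x · y) ≈ 1#)

  HasCardinality : ℕ → Set (c Level.⊔ ℓ)
  HasCardinality q = Σ (Fin q → Carrier) λ f →
    (∀ i j → f i ≈ f j → i ≡ j) × (∀ x → ∃ λ i → f i ≈ x)

-- An encoding on n packets: a single packet p_j (loop) or p_j + p_k with j ≠ k.
data Enc (n : ℕ) : Set where
  loop : Fin n → Enc n
  pair : (j k : Fin n) → j ≢ k → Enc n

Graph : ℕ → ℕ → Set
Graph n m = Fin m → Enc n

-- 1 if the edge is incident with v (a loop counts once), else 0.
incident : {n : ℕ} → Enc n → Fin n → ℕ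
incident (loop j) v = if does (j ≟ v) then 1 else 0
incident (pair j k _) v = if does (j ≟ v) ∨ does (k ≟ v) then 1 else 0

dI : {n m : ℕ} → Graph n m → Fin n → ℕ
dI {m = m} G v = sum (map (λ i → incident (G i) v) (allFin m))

-- minimum of a function on Fin n (0 for n = 0, irrelevant since n ≥ 2)
minFin : (n : ℕ) → (Fin n → ℕ) → ℕ
minFin zero f = 0
minFin (suc zero) f = f zero
minFin (suc (suc n)) f = f zero ⊓ minFin (suc n) (λ i → f (suc i))

δI : {n m : ℕ} → Graph n m → ℕ
δI {n = n} G = minFin n (dI G)

module _ {c ℓ : Level} (R : CommutativeRing c ℓ) where
  open CommutativeRing R using (Carrier; _≈_) renaming (_+_ to _⊕_)

  -- value of an encoding on packets p : Fin n → GF(q)^len (coordinatewise)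
  enc : {n len : ℕ} → Enc n → (Fin n → Fin len → Carrier) → Fin len → Carrier
  enc (loop j) p t = p j t
  enc (pair j k _) p t = p j t ⊕ p k t

  Decodable : {n m : ℕ} → (len : ℕ) → Graph n m → Subset m → Set (c Level.⊔ ℓ)
  Decodable {n} {m} len G S = ∀ (p p′ : Fin n → Fin len → Carrier) →
    (∀ i → i ∈ S → ∀ t → enc (G i) p t ≈ enc (G i) p′ t) →
    ∀ j t → p j t ≈ p′ j t

  IsBG : {n m : ℕ} → (len : ℕ) → Graph n m → ℕ → Set (c Level.⊔ ℓ)
  IsBG {n} {m} len G b =
    (Σ (Subset m) λ L → (∣ L ∣ ≡ b) × ¬ Decodable len G (Data.Fin.Subset.∁ L)) ×
    (∀ (L : Subset m) → ¬ Decodable len G (Data.Fin.Subset.∁ L) → b ≤ ∣ L ∣)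

module Submission where

-- Each edge is incident with
-- at most two vertices, so double counting incidences gives the handshake
-- inequality  ∑_v d_I(v) ≤ 2m.  Consequently any c bounding every degree from
-- below satisfies  c·n ≤ 2m.  The minimum degree δ_I(G) is such a bound.
-- So is b_G: removing the "star" of a vertex v (all edges incident with v)
-- leaves a subgraph that cannot distinguish the all-zero packets from the
-- packets that are 1 at v and 0 elsewhere (this only needs 1 ≠ 0 and
-- packets of positive length), hence b_G ≤ |star(v)| = d_I(v) for every v.

open import Defs
open import Level using (Level)
open import Data.Nat using (ℕ; zero; suc; _+_; _*_; _≤_; z≤n; s≤s)
open import Data.Nat.Properties
  using (≤-refl; ≤-trans; ≤-reflexive; +-mono-≤; *-suc; *-zeroʳ; m⊓n≤m; m⊓n≤n;
         +-0-commutativeMonoid)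
open import Data.Nat.ListAction as List using ()
open import Data.Bool using (Bool; true; false; if_then_else_; _∨_)
open import Data.Fin using (Fin; zero; suc; _≟_)
open import Data.Fin.Subset using (Subset; _∈_; ∣_∣; ∁; ⊤)
open import Data.Fin.Subset.Properties using (x∈∁p⇒x∉p)
import Data.List as L
open import Data.List.Properties using (map-tabulate)
open import Data.Vec using (tabulate)
open import Data.Vec.Properties using (lookup⇒[]=; lookup∘tabulate)
open import Data.Product using (_×_; _,_; proj₁)
open import Relation.Nullary using (¬_; does; yes; no; contradiction)
open import Relation.Binary.PropositionalEquality
  using (_≡_; refl; sym; trans; cong; cong₂; subst; module ≡-Reasoning)
open import Algebra.Bundles using (CommutativeRing)
open import Algebra.Properties.CommutativeMonoid.Sum +-0-commutativeMonoid
  using (sum-syntax; sum-cong-≗; ∑-comm; ∑-distrib-+; sum-replicate-zero)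

∑-mono-≤ : ∀ {n} (f g : Fin n → ℕ) → (∀ i → f i ≤ g i) →
  ∑[ i < n ] f i ≤ ∑[ i < n ] g i
∑-mono-≤ {zero}  f g f≤g = z≤n
∑-mono-≤ {suc n} f g f≤g =
  +-mono-≤ (f≤g zero) (∑-mono-≤ (λ i → f (suc i)) (λ i → g (suc i)) (λ i → f≤g (suc i)))

∑-const : ∀ n c → ∑[ i < n ] c ≡ c * n
∑-const zero    c = sym (*-zeroʳ c)
∑-const (suc n) c = trans (cong (c +_) (∑-const n c)) (sym (*-suc c n))

∑-lowerBound : ∀ {n} c (f : Fin n → ℕ) → (∀ i → c ≤ f i) → c * n ≤ ∑[ i < n ] f i
∑-lowerBound {n} c f c≤f = ≤-trans (≤-reflexive (sym (∑-const n c))) (∑-mono-≤ _ f c≤f)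

sum-allFin : ∀ {m} (f : Fin m → ℕ) → List.sum (L.map f (L.allFin m)) ≡ ∑[ i < m ] f i
sum-allFin f = trans (cong List.sum (map-tabulate (λ i → i) f)) (sum-tabulate f)
  where
  sum-tabulate : ∀ {m} (f : Fin m → ℕ) → List.sum (L.tabulate f) ≡ ∑[ i < m ] f i
  sum-tabulate {zero}  f = refl
  sum-tabulate {suc m} f = cong (f zero +_) (sum-tabulate (λ i → f (suc i)))

indicator : Bool → ℕ
indicator b = if b then 1 else 0

isIncident : ∀ {n} → Enc n → Fin n → Bool
isIncident (loop j)     v = does (j ≟ v)
isIncident (pair j k _) v = does (j ≟ v) ∨ does (k ≟ v)

incident-isIncident : ∀ {n} (e : Enc n) v → incident e v ≡ indicator (isIncident e v)
incident-isIncident (loop j)     v = refl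
incident-isIncident (pair j k _) v = refl

indicator-∨ : ∀ a b → indicator (a ∨ b) ≤ indicator a + indicator b
indicator-∨ true  b = s≤s z≤n
indicator-∨ false b = ≤-refl

∑-indicator-≟ : ∀ {n} (j : Fin n) → ∑[ v < n ] indicator (does (j ≟ v)) ≡ 1
∑-indicator-≟ {suc n} zero    = cong suc (sum-replicate-zero n)
∑-indicator-≟ {suc n} (suc j) = ∑-indicator-≟ j

incidences≤2 : ∀ {n} (e : Enc n) → ∑[ v < n ] incident e v ≤ 2
incidences≤2 (loop j) = ≤-trans (≤-reflexive (∑-indicator-≟ j)) (s≤s z≤n)
incidences≤2 {n} (pair j k _) = begin
  ∑[ v < n ] indicator (does (j ≟ v) ∨ does (k ≟ v))
    ≤⟨ ∑-mono-≤ _ _ (λ v → indicator-∨ (does (j ≟ v)) (does (k ≟ v))) ⟩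
  ∑[ v < n ] (indicator (does (j ≟ v)) + indicator (does (k ≟ v)))
    ≡⟨ ∑-distrib-+ (λ v → indicator (does (j ≟ v))) (λ v → indicator (does (k ≟ v))) ⟩
  ∑[ v < n ] indicator (does (j ≟ v)) + ∑[ v < n ] indicator (does (k ≟ v))
    ≡⟨ cong₂ _+_ (∑-indicator-≟ j) (∑-indicator-≟ k) ⟩
  2 ∎
  where open Data.Nat.Properties.≤-Reasoning

handshake : ∀ {n m} (G : Graph n m) → ∑[ v < n ] dI G v ≤ 2 * m
handshake {n} {m} G = begin
  ∑[ v < n ] dI G v                           ≡⟨ sum-cong-≗ (λ v → sum-allFin (λ i → incident (G i) v)) ⟩
  ∑[ v < n ] ∑[ i < m ] incident (G i) v      ≡⟨ ∑-comm (λ v i → incident (G i) v) ⟩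
  ∑[ i < m ] ∑[ v < n ] incident (G i) v      ≤⟨ ∑-mono-≤ _ _ (λ i → incidences≤2 (G i)) ⟩
  ∑[ i < m ] 2                                ≡⟨ ∑-const m 2 ⟩
  2 * m                                       ∎
  where open Data.Nat.Properties.≤-Reasoning

degreeLowerBound : ∀ {n m} (G : Graph n m) c → (∀ v → c ≤ dI G v) → c * n ≤ 2 * m
degreeLowerBound G c c≤dI = ≤-trans (∑-lowerBound c (dI G) c≤dI) (handshake G)

minFin-≤ : ∀ n (f : Fin n → ℕ) i → minFin n f ≤ f i
minFin-≤ (suc zero)    f zero    = ≤-refl
minFin-≤ (suc (suc n)) f zero    = m⊓n≤m _ _
minFin-≤ (suc (suc n)) f (suc i) = ≤-trans (m⊓n≤n _ _) (minFin-≤ (suc n) (λ i → f (suc i)) i)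

star : ∀ {n m} → Graph n m → Fin n → Subset m
star G v = tabulate (λ i → isIncident (G i) v)

∣tabulate∣ : ∀ {m} (g : Fin m → Bool) → ∣ tabulate g ∣ ≡ ∑[ i < m ] indicator (g i)
∣tabulate∣ {zero}  g = refl
∣tabulate∣ {suc m} g with g zero
... | true  = cong suc (∣tabulate∣ (λ i → g (suc i)))
... | false = ∣tabulate∣ (λ i → g (suc i))

∣star∣ : ∀ {n m} (G : Graph n m) v → ∣ star G v ∣ ≡ dI G v
∣star∣ G v = begin
  ∣ star G v ∣                                     ≡⟨ ∣tabulate∣ (λ i → isIncident (G i) v) ⟩
  ∑[ i < _ ] indicator (isIncident (G i) v)        ≡⟨ sum-cong-≗ (λ i → incident-isIncident (G i) v) ⟨
  ∑[ i < _ ] incident (G i) v                      ≡⟨ sum-allFin (λ i → incident (G i) v) ⟨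
  dI G v                                           ∎
  where open ≡-Reasoning

∁star-avoids : ∀ {n m} (G : Graph n m) v i → i ∈ ∁ (star G v) → isIncident (G i) v ≡ false
∁star-avoids G v i i∈∁ with isIncident (G i) v in incident≡
... | false = refl
... | true  = contradiction (lookup⇒[]= i _ (trans (lookup∘tabulate _ i) incident≡))
                            (x∈∁p⇒x∉p i∈∁)

module _ {c ℓ : Level} (R : CommutativeRing c ℓ) where
  open CommutativeRing R using (Carrier; _≈_; 0#; 1#) renaming (refl to ≈-refl; sym to ≈-sym)

  pointMass : ∀ {n len} → Fin n → Fin n → Fin len → Carrier
  pointMass v j t = if does (j ≟ v) then 1# else 0#

  pointMass-invisible : ∀ {n len} (e : Enc n) v → isIncident e v ≡ false → ∀ t →
    enc R e (λ _ _ → 0#) t ≈ enc R e (pointMass {len = len} v) t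
  pointMass-invisible (loop j) v avoids t rewrite avoids = ≈-refl
  pointMass-invisible (pair j k _) v avoids t with does (j ≟ v) | does (k ≟ v)
  pointMass-invisible (pair j k _) v refl t | false | false = ≈-refl

  pointMass-self : ∀ {n len} (v : Fin n) (t : Fin len) → pointMass v v t ≡ 1#
  pointMass-self v t with v ≟ v
  ... | yes _  = refl
  ... | no v≢v = contradiction refl v≢v

  avoiding-undecodable : ∀ {n m len} → 1 ≤ len → ¬ (1# ≈ 0#) →
    (G : Graph n m) (S : Subset m) (v : Fin n) →
    (∀ i → i ∈ S → isIncident (G i) v ≡ false) → ¬ Decodable R len G S
  avoiding-undecodable {len = suc len} _ 1≉0 G S v avoids decodable =
    1≉0 (≈-sym (subst (0# ≈_) (pointMass-self {len = suc len} v zero) zero≈pointMass))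
    where
    zero≈pointMass : 0# ≈ pointMass {len = suc len} v v zero
    zero≈pointMass = decodable (λ _ _ → 0#) (pointMass v)
      (λ i i∈S → pointMass-invisible (G i) v (avoids i i∈S)) v zero

  -- b_G is at most every degree: deleting the star of v makes G undecodable.
  bG-≤-degree : ∀ {n m len b} (G : Graph n m) → 1 ≤ len → ¬ (1# ≈ 0#) →
    IsBG R len G b → ∀ v → b ≤ dI G v
  bG-≤-degree G len≥1 1≉0 (_ , minimal) v =
    ≤-trans (minimal (star G v) (avoiding-undecodable len≥1 1≉0 G _ v (∁star-avoids G v)))
            (≤-reflexive (∣star∣ G v))

-- Lemma 6: δ_I(G)·n ≤ 2m and b_G·n ≤ 2m.
lemma6 : ∀ {c ℓ : Level} (R : CommutativeRing c ℓ) (q : ℕ) →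
    OddPrimePower q → IsField R → HasCardinality R q →
    (len n m : ℕ) → 1 ≤ len → 2 ≤ n → (G : Graph n m) →
    Decodable R len G ⊤ →
    (δI G * n ≤ 2 * m) × (∀ b → IsBG R len G b → b * n ≤ 2 * m)
lemma6 R q _ isField _ len n m len≥1 _ G _ =
  degreeLowerBound G (δI G) (minFin-≤ n (dI G)) ,
  λ b isBG → degreeLowerBound G b (bG-≤-degree R G len≥1 (proj₁ isField) isBG)
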